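{- For all $n,m\in\mathbb{N}$, $\mu(n,m)\le U(n,m)$.
   Context: $\mathbb{F}_2$ is the field with two elements. For $u\in\mathbb{F}_2^n$, $|u|$ is the number of entries of $u$ equal to $1$. For an $n\times n$ matrix $W$ over $\mathbb{F}_2$, $M(W,0)=\max\{|Wx| : x\in\mathbb{F}_2^n\}$. For $n,m\ge 1$, $A(n,m)$ is the set of $n\times n$ matrices over $\mathbb{F}_2$ with all diagonal entries $1$ and every column containing at most $m$ ones, and $\mu(n,m)=\min\{M(W,0):W\in A(n,m)\}$. The sequence $(a(n))_{n\ge1}$ is defined by $a(1)=1$; $a(2^k-1+i)=2^{k-1}+a(i)$ for $1\le i\le 2^k-1$, $k\in\mathbb{N}$; and $a(2^{k+1}-1)=2^k$ for $k\in\mathbb{N}$ (so it begins $1,2,2,3,4,4,4,5,6,6,7,8,8,8,8,9,\dots$). For $n,m\in\mathbb{N}$, let $k\ge0$ be the integer with $2^k\le m<2^{k+1}$, and let $q\ge 0$ and $1\le r\le 2^{k+1}-1$ be the integers with $n=(2^{k+1}-1)q+r$; then $U(n,m)=q2^k+a(r)$. -}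

module Defs where

open import Data.Bool using (Bool; true; false; _xor_; _∧_; T)
open import Data.Nat using (ℕ; zero; suc; _+_; _*_; _∸_; _^_; _≤_; _<_; _⊔_; _⊓_; _≤ᵇ_; _≡ᵇ_)
open import Data.Nat.DivMod using (_/_; _%_)
open import Data.Nat.Logarithm using (⌊log₂_⌋)
open import Data.List using (List; []; _∷_; foldr; map; filter; concatMap)
open import Data.Vec using (Vec; []; _∷_; foldr′; zipWith; lookup; countᵇ; transpose; tabulate; allFin)
open import Data.Vec.Relation.Unary.All using (All)
open import Data.Fin using (Fin)
open import Relation.Unary using (Decidable)
open import Data.Product using (_×_)

-- vectors in F₂ⁿ and n×n matrices over F₂ (a matrix is its list of rows)
F₂^ : ℕ → Set
F₂^ n = Vec Bool n

Mat : ℕ → Set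
Mat n = Vec (Vec Bool n) n

∣_∣ : ∀ {n} → F₂^ n → ℕ
∣ u ∣ = countᵇ (λ b → b) u

dot : ∀ {n} → F₂^ n → F₂^ n → Bool
dot u v = foldr′ _xor_ false (zipWith _∧_ u v)

_·_ : ∀ {n} → Mat n → F₂^ n → F₂^ n
W · x = Data.Vec.map (λ row → dot row x) W

allVecs : ∀ {A : Set} → List A → (n : ℕ) → List (Vec A n)
allVecs xs zero = [] ∷ []
allVecs xs (suc n) = concatMap (λ a → map (a ∷_) (allVecs xs n)) xs

allF₂^ : (n : ℕ) → List (F₂^ n)
allF₂^ = allVecs (false ∷ true ∷ [])

allMat : (n : ℕ) → List (Mat n)
allMat n = allVecs (allF₂^ n) n

M₀ : ∀ {n} → Mat n → ℕ
M₀ {n} W = foldr _⊔_ 0 (map (λ x → ∣ W · x ∣) (allF₂^ n))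

inAᵇ : ∀ {n} → ℕ → Mat n → Bool
inAᵇ {n} m W =
  foldr _∧_ true (Data.Vec.toList (tabulate (λ i → lookup (lookup W i) i)))
  ∧ foldr _∧_ true (Data.Vec.toList (Data.Vec.map (λ col → ∣ col ∣ ≤ᵇ m) (transpose W)))

A : (n m : ℕ) → List (Mat n)
A n m = filter (λ W → Data.Bool._≟_ (inAᵇ m W) true) (allMat n)

-- μ(n,m) = min { M(W,0) : W ∈ A(n,m) }.
-- The fold starts from n, which is harmless: M(W,0) ≤ n for every W,
-- and A(n,m) contains the identity matrix for n,m ≥ 1.
μ : ℕ → ℕ → ℕ
μ n m = foldr _⊓_ n (map M₀ (A n m))

-- Fuel-driven implementation of the recursion
--   a(1) = 1,
--   a(2^(k+1) - 1) = 2^k,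
--   a(2^k - 1 + i) = 2^(k-1) + a(i)   for 1 ≤ i ≤ 2^k - 1.
-- With K = ⌊log₂(n+1)⌋ we have 2^K ≤ n+1 < 2^(K+1):
--   if n + 1 = 2^K then a(n) = 2^(K-1), otherwise i = n + 1 - 2^K ∈ [1, 2^K - 1]
--   and a(n) = 2^(K-1) + a(i), with i < n.  Fuel n suffices.
aF : ℕ → ℕ → ℕ
aF zero n = 0
aF (suc f) n with (n + 1) ≡ᵇ 2 ^ ⌊log₂ (n + 1) ⌋
... | true  = 2 ^ (⌊log₂ (n + 1) ⌋ ∸ 1)
... | false = 2 ^ (⌊log₂ (n + 1) ⌋ ∸ 1) + aF f (n + 1 ∸ 2 ^ ⌊log₂ (n + 1) ⌋)

a : ℕ → ℕ
a n = aF n n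

-- U(n,m): k = ⌊log₂ m⌋, n = (2^(k+1) - 1) q + r with 1 ≤ r ≤ 2^(k+1) - 1,
-- i.e. q = (n - 1) / (2^(k+1) - 1), r = (n - 1) mod (2^(k+1) - 1) + 1  (n ≥ 1).
-- 2^(k+1) - 1 = suc (2 * 2^k - 2) written as suc(...) so the divisor is NonZero.
B : ℕ → ℕ
B m = suc (2 ^ suc ⌊log₂ m ⌋ ∸ 2)

U : ℕ → ℕ → ℕ
U n m = ((n ∸ 1) / B m) * 2 ^ ⌊log₂ m ⌋ + a ((n ∸ 1) % B m + 1)

-- Call S a simplex matrix of order k if S ∈ A(2^(k+1) - 1, 2^k) and
-- every |Sx| is at most 2^k.  The 1×1 identity is one of order 0, and if S has
-- order k then the doubling [S S 0; S S 1; 0 0 1] has order k + 1: an input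
-- (y, z, t) is sent to (v, v + t·𝟏, t) with v = S(y + z), of weight 2|v| when
-- t = 0 and 2^(k+1) when t = 1.  Block-diagonal sums add sizes and the bounds on
-- |Wx|, and keep the column bound.  Writing n = (2^(k+1) - 1) q + r, we tile n
-- with q simplex blocks of order k = ⌊log₂ m⌋ and decompose r greedily into
-- simplex blocks of decreasing orders; the recursion defining a(r) is exactly
-- the sum of the resulting bounds, so the tiling witnesses μ(n, m) ≤ U(n, m).
module Submission where

open import Defs
open import Algebra.Bundles using (CommutativeRing)
open import Data.Bool using (Bool; true; false; _xor_; _∧_; T)
open import Data.Bool.ListAction using (and)
open import Data.Bool.Properties
  using (xor-assoc; xor-identityˡ; xor-identityʳ; ∧-zeroʳ; ∧-distribˡ-xor; xor-∧-commutativeRing; T-≡)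
open import Data.Empty using (⊥-elim)
open import Data.Fin using (Fin; zero; suc; _↑ˡ_; _↑ʳ_; join)
import Data.Fin as Fin
open import Data.Fin.Properties using (join-splitAt)
open import Data.List using (List; []; _∷_; foldr; concatMap; filter)
import Data.List as List
open import Data.List.Membership.Propositional using (_∈_)
open import Data.List.Membership.Propositional.Properties
  using (∈-map⁺; ∈-++⁺ˡ; ∈-++⁺ʳ; ∈-filter⁺)
open import Data.List.Relation.Unary.Any using (here; there)
open import Data.Nat
  using (ℕ; zero; suc; _+_; _*_; _∸_; _^_; _≤_; _<_; _⊔_; _⊓_; _≡ᵇ_; _≤ᵇ_; z≤n; s≤s; ⌊_/2⌋; ⌈_/2⌉)
open import Data.Nat.Properties
open import Data.Nat.DivMod using (_/_; _%_; m≡m%n+[m/n]*n; m%n<n)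
open import Data.Nat.Logarithm using (⌊log₂_⌋; ⌊log₂⌋-mono-≤; ⌊log₂[2^n]⌋≡n)
open import Data.Nat.Logarithm.Core using (⌊log2⌋)
open import Data.Product using (_,_)
open import Data.Sum using ([_,_])
open import Data.Unit using (tt)
open import Data.Vec
  using (Vec; []; _∷_; _++_; map; replicate; zipWith; lookup; tabulate; transpose; toList; splitAt; _⊛_)
open import Data.Vec.Properties
  using ( map-++; map-replicate; lookup-map; lookup-++ˡ; lookup-++ʳ; lookup-zipWith; lookup-replicate
        ; lookup∘tabulate; lookup-⊛; zipWith-++; zipWith-identityˡ; zipWith-identityʳ)
open import Function.Bundles using (Equivalence)
open import Induction.WellFounded using (Acc; acc)
open import Relation.Binary.PropositionalEquality
open import Algebra.Properties.CommutativeSemigroup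
  (CommutativeRing.+-commutativeSemigroup xor-∧-commutativeRing) using (interchange)

zeros ones : ∀ n → F₂^ n
zeros n = replicate n false
ones n = replicate n true

infixl 6 _⊕_

_⊕_ : ∀ {n} → F₂^ n → F₂^ n → F₂^ n
_⊕_ = zipWith _xor_

⊕-identityʳ : ∀ {n} (u : F₂^ n) → u ⊕ zeros n ≡ u
⊕-identityʳ = zipWith-identityʳ xor-identityʳ

⊕-identityˡ : ∀ {n} (u : F₂^ n) → zeros n ⊕ u ≡ u
⊕-identityˡ = zipWith-identityˡ xor-identityˡ

∣++∣ : ∀ {m n} (u : F₂^ m) (v : F₂^ n) → ∣ u ++ v ∣ ≡ ∣ u ∣ + ∣ v ∣
∣++∣ [] v = refl
∣++∣ (true ∷ u) v = cong suc (∣++∣ u v)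
∣++∣ (false ∷ u) v = ∣++∣ u v

∣zeros∣ : ∀ n → ∣ zeros n ∣ ≡ 0
∣zeros∣ zero = refl
∣zeros∣ (suc n) = ∣zeros∣ n

∣ones∣ : ∀ n → ∣ ones n ∣ ≡ n
∣ones∣ zero = refl
∣ones∣ (suc n) = cong suc (∣ones∣ n)

∣u∣+∣u⊕ones∣≡n : ∀ {n} (u : F₂^ n) → ∣ u ∣ + ∣ u ⊕ ones n ∣ ≡ n
∣u∣+∣u⊕ones∣≡n [] = refl
∣u∣+∣u⊕ones∣≡n (true ∷ u) = cong suc (∣u∣+∣u⊕ones∣≡n u)
∣u∣+∣u⊕ones∣≡n (false ∷ u) = trans (+-suc ∣ u ∣ _) (cong suc (∣u∣+∣u⊕ones∣≡n u))

dot-++ : ∀ {m n} (r x : F₂^ m) (s y : F₂^ n) → dot (r ++ s) (x ++ y) ≡ dot r x xor dot s y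
dot-++ [] [] s y = refl
dot-++ (p ∷ r) (b ∷ x) s y =
  trans (cong ((p ∧ b) xor_) (dot-++ r x s y)) (sym (xor-assoc (p ∧ b) (dot r x) (dot s y)))

dot-zerosˡ : ∀ {n} (x : F₂^ n) → dot (zeros n) x ≡ false
dot-zerosˡ [] = refl
dot-zerosˡ (_ ∷ x) = dot-zerosˡ x

dot-zerosʳ : ∀ {n} (r : F₂^ n) → dot r (zeros n) ≡ false
dot-zerosʳ [] = refl
dot-zerosʳ (p ∷ r) = cong₂ _xor_ (∧-zeroʳ p) (dot-zerosʳ r)

dot-⊕ʳ : ∀ {n} (r x y : F₂^ n) → dot r (x ⊕ y) ≡ dot r x xor dot r y
dot-⊕ʳ [] [] [] = refl
dot-⊕ʳ (p ∷ r) (b ∷ x) (c ∷ y) = begin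
  (p ∧ (b xor c)) xor dot r (x ⊕ y)
    ≡⟨ cong₂ _xor_ (∧-distribˡ-xor p b c) (dot-⊕ʳ r x y) ⟩
  ((p ∧ b) xor (p ∧ c)) xor (dot r x xor dot r y)
    ≡⟨ interchange (p ∧ b) (p ∧ c) (dot r x) (dot r y) ⟩
  ((p ∧ b) xor dot r x) xor ((p ∧ c) xor dot r y) ∎
  where open ≡-Reasoning

Matrix : ℕ → ℕ → Set
Matrix k n = Vec (F₂^ n) k

-- On square matrices this is Defs._·_ by definition.
infixr 7 _⊙_

_⊙_ : ∀ {k n} → Matrix k n → F₂^ n → F₂^ k
W ⊙ x = map (λ row → dot row x) W

O : ∀ k n → Matrix k n
O k n = replicate k (zeros n)

I₁ : Mat 1
I₁ = (true ∷ []) ∷ []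

column : ∀ {k n} → Matrix k n → Fin n → F₂^ k
column W j = map (λ row → lookup row j) W

_∥_ : ∀ {k m n} → Matrix k m → Matrix k n → Matrix k (m + n)
_∥_ = zipWith _++_

block : ∀ {k₁ k₂ n₁ n₂} → Matrix k₁ n₁ → Matrix k₁ n₂ → Matrix k₂ n₁ → Matrix k₂ n₂ →
        Matrix (k₁ + k₂) (n₁ + n₂)
block P Q R S = (P ∥ Q) ++ (R ∥ S)

UnitDiagonal : ∀ {n} → Mat n → Set
UnitDiagonal W = ∀ i → lookup (lookup W i) i ≡ true

↑-split : ∀ {m n} {P : Fin (m + n) → Set} →
          (∀ i → P (i ↑ˡ n)) → (∀ j → P (m ↑ʳ j)) → ∀ i → P i
↑-split {m} {n} {P} pˡ pʳ i =
  subst P (join-splitAt m n i) ([_,_] {C = λ s → P (join m n s)} pˡ pʳ (Fin.splitAt m i))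

++-split : ∀ {A : Set} {m n} {P : Vec A (m + n) → Set} → (∀ x y → P (x ++ y)) → ∀ z → P z
++-split {m = m} p z with splitAt m z
... | x , y , refl = p x y

⊙-⊕ : ∀ {k n} (W : Matrix k n) x y → W ⊙ (x ⊕ y) ≡ W ⊙ x ⊕ W ⊙ y
⊙-⊕ [] x y = refl
⊙-⊕ (r ∷ W) x y = cong₂ _∷_ (dot-⊕ʳ r x y) (⊙-⊕ W x y)

⊙-zeros : ∀ {k n} (W : Matrix k n) → W ⊙ zeros n ≡ zeros k
⊙-zeros [] = refl
⊙-zeros (r ∷ W) = cong₂ _∷_ (dot-zerosʳ r) (⊙-zeros W)

O-⊙ : ∀ k {n} (x : F₂^ n) → O k n ⊙ x ≡ zeros k
O-⊙ zero x = refl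
O-⊙ (suc k) x = cong₂ _∷_ (dot-zerosˡ x) (O-⊙ k x)

∥-⊙ : ∀ {k m n} (P : Matrix k m) (Q : Matrix k n) x y → (P ∥ Q) ⊙ (x ++ y) ≡ P ⊙ x ⊕ Q ⊙ y
∥-⊙ [] [] x y = refl
∥-⊙ (p ∷ P) (q ∷ Q) x y = cong₂ _∷_ (dot-++ p x q y) (∥-⊙ P Q x y)

block-⊙ : ∀ {k₁ k₂ n₁ n₂} (P : Matrix k₁ n₁) (Q : Matrix k₁ n₂) (R : Matrix k₂ n₁) (S : Matrix k₂ n₂) x y →
          block P Q R S ⊙ (x ++ y) ≡ (P ⊙ x ⊕ Q ⊙ y) ++ (R ⊙ x ⊕ S ⊙ y)
block-⊙ P Q R S x y =
  trans (map-++ (λ row → dot row (x ++ y)) (P ∥ Q) (R ∥ S)) (cong₂ _++_ (∥-⊙ P Q x y) (∥-⊙ R S x y))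

column-O : ∀ k {n} (j : Fin n) → column (O k n) j ≡ zeros k
column-O k {n} j = trans (map-replicate (λ row → lookup row j) (zeros n) k)
                         (cong (replicate k) (lookup-replicate j false))

∣column-++∣ : ∀ {k₁ k₂ n} (P : Matrix k₁ n) (R : Matrix k₂ n) j →
              ∣ column (P ++ R) j ∣ ≡ ∣ column P j ∣ + ∣ column R j ∣
∣column-++∣ P R j = trans (cong ∣_∣ (map-++ (λ row → lookup row j) P R)) (∣++∣ (column P j) (column R j))

column-∥ˡ : ∀ {k m n} (P : Matrix k m) (Q : Matrix k n) j → column (P ∥ Q) (j ↑ˡ n) ≡ column P j
column-∥ˡ [] [] j = refl
column-∥ˡ (p ∷ P) (q ∷ Q) j = cong₂ _∷_ (lookup-++ˡ p q j) (column-∥ˡ P Q j)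

column-∥ʳ : ∀ {k m n} (P : Matrix k m) (Q : Matrix k n) j → column (P ∥ Q) (m ↑ʳ j) ≡ column Q j
column-∥ʳ [] [] j = refl
column-∥ʳ (p ∷ P) (q ∷ Q) j = cong₂ _∷_ (lookup-++ʳ p q j) (column-∥ʳ P Q j)

∣column-block-↑ˡ∣ : ∀ {k₁ k₂ n₁ n₂} (P : Matrix k₁ n₁) (Q : Matrix k₁ n₂) (R : Matrix k₂ n₁) (S : Matrix k₂ n₂) j →
                    ∣ column (block P Q R S) (j ↑ˡ n₂) ∣ ≡ ∣ column P j ∣ + ∣ column R j ∣
∣column-block-↑ˡ∣ P Q R S j = trans (∣column-++∣ (P ∥ Q) (R ∥ S) (j ↑ˡ _))
  (cong₂ (λ u v → ∣ u ∣ + ∣ v ∣) (column-∥ˡ P Q j) (column-∥ˡ R S j))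

∣column-block-↑ʳ∣ : ∀ {k₁ k₂ n₁ n₂} (P : Matrix k₁ n₁) (Q : Matrix k₁ n₂) (R : Matrix k₂ n₁) (S : Matrix k₂ n₂) j →
                    ∣ column (block P Q R S) (n₁ ↑ʳ j) ∣ ≡ ∣ column Q j ∣ + ∣ column S j ∣
∣column-block-↑ʳ∣ {n₁ = n₁} P Q R S j = trans (∣column-++∣ (P ∥ Q) (R ∥ S) (n₁ ↑ʳ j))
  (cong₂ (λ u v → ∣ u ∣ + ∣ v ∣) (column-∥ʳ P Q j) (column-∥ʳ R S j))

block-unitDiagonal : ∀ {m n} (P : Mat m) (Q : Matrix m n) (R : Matrix n m) (S : Mat n) →
                     UnitDiagonal P → UnitDiagonal S → UnitDiagonal (block P Q R S)
block-unitDiagonal {m} {n} P Q R S diagP diagS = ↑-split upper lower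
  where
  open ≡-Reasoning
  upper : ∀ i → lookup (lookup (block P Q R S) (i ↑ˡ n)) (i ↑ˡ n) ≡ true
  upper i = begin
    lookup (lookup (block P Q R S) (i ↑ˡ n)) (i ↑ˡ n)
      ≡⟨ cong (λ row → lookup row (i ↑ˡ n)) (lookup-++ˡ (P ∥ Q) (R ∥ S) i) ⟩
    lookup (lookup (P ∥ Q) i) (i ↑ˡ n)
      ≡⟨ cong (λ row → lookup row (i ↑ˡ n)) (lookup-zipWith _++_ i P Q) ⟩
    lookup (lookup P i ++ lookup Q i) (i ↑ˡ n)
      ≡⟨ lookup-++ˡ (lookup P i) (lookup Q i) i ⟩
    lookup (lookup P i) i
      ≡⟨ diagP i ⟩
    true ∎
  lower : ∀ i → lookup (lookup (block P Q R S) (m ↑ʳ i)) (m ↑ʳ i) ≡ true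
  lower i = begin
    lookup (lookup (block P Q R S) (m ↑ʳ i)) (m ↑ʳ i)
      ≡⟨ cong (λ row → lookup row (m ↑ʳ i)) (lookup-++ʳ (P ∥ Q) (R ∥ S) i) ⟩
    lookup (lookup (R ∥ S) i) (m ↑ʳ i)
      ≡⟨ cong (λ row → lookup row (m ↑ʳ i)) (lookup-zipWith _++_ i R S) ⟩
    lookup (lookup R i ++ lookup S i) (m ↑ʳ i)
      ≡⟨ lookup-++ʳ (lookup R i) (lookup S i) i ⟩
    lookup (lookup S i) i
      ≡⟨ diagS i ⟩
    true ∎

record Witness (n m u : ℕ) : Set where
  field
    matrix       : Mat n
    unitDiagonal : UnitDiagonal matrix
    column≤      : ∀ j → ∣ column matrix j ∣ ≤ m
    image≤       : ∀ x → ∣ matrix · x ∣ ≤ u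

open Witness

weaken : ∀ {n m m′ u} → m ≤ m′ → Witness n m u → Witness n m′ u
weaken m≤m′ w = record
  { matrix = matrix w ; unitDiagonal = unitDiagonal w
  ; column≤ = λ j → ≤-trans (column≤ w j) m≤m′ ; image≤ = image≤ w }

empty : ∀ {m} → Witness 0 m 0
empty = record { matrix = [] ; unitDiagonal = λ () ; column≤ = λ () ; image≤ = λ _ → z≤n }

blockDiagonal : ∀ {n₁ n₂ m u₁ u₂} → Witness n₁ m u₁ → Witness n₂ m u₂ → Witness (n₁ + n₂) m (u₁ + u₂)
blockDiagonal {n₁} {n₂} {m} {u₁} {u₂} w₁ w₂ = record
  { matrix       = D
  ; unitDiagonal = block-unitDiagonal W₁ (O n₁ n₂) (O n₂ n₁) W₂ (unitDiagonal w₁) (unitDiagonal w₂)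
  ; column≤      = ↑-split left right
  ; image≤       = ++-split image
  }
  where
  open ≤-Reasoning
  W₁ = matrix w₁
  W₂ = matrix w₂
  D = block W₁ (O n₁ n₂) (O n₂ n₁) W₂

  left : ∀ j → ∣ column D (j ↑ˡ n₂) ∣ ≤ m
  left j = begin
    ∣ column D (j ↑ˡ n₂) ∣              ≡⟨ ∣column-block-↑ˡ∣ W₁ (O n₁ n₂) (O n₂ n₁) W₂ j ⟩
    ∣ column W₁ j ∣ + ∣ column (O n₂ n₁) j ∣ ≡⟨ cong (λ c → ∣ column W₁ j ∣ + ∣ c ∣) (column-O n₂ j) ⟩
    ∣ column W₁ j ∣ + ∣ zeros n₂ ∣        ≡⟨ cong (∣ column W₁ j ∣ +_) (∣zeros∣ n₂) ⟩
    ∣ column W₁ j ∣ + 0                  ≡⟨ +-identityʳ _ ⟩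
    ∣ column W₁ j ∣                      ≤⟨ column≤ w₁ j ⟩
    m                                    ∎

  right : ∀ j → ∣ column D (n₁ ↑ʳ j) ∣ ≤ m
  right j = begin
    ∣ column D (n₁ ↑ʳ j) ∣              ≡⟨ ∣column-block-↑ʳ∣ W₁ (O n₁ n₂) (O n₂ n₁) W₂ j ⟩
    ∣ column (O n₁ n₂) j ∣ + ∣ column W₂ j ∣ ≡⟨ cong (λ c → ∣ c ∣ + ∣ column W₂ j ∣) (column-O n₁ j) ⟩
    ∣ zeros n₁ ∣ + ∣ column W₂ j ∣        ≡⟨ cong (_+ ∣ column W₂ j ∣) (∣zeros∣ n₁) ⟩
    ∣ column W₂ j ∣                      ≤⟨ column≤ w₂ j ⟩
    m                                    ∎

  image : ∀ x y → ∣ D · (x ++ y) ∣ ≤ u₁ + u₂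
  image x y = begin
    ∣ D ⊙ (x ++ y) ∣
      ≡⟨ cong ∣_∣ (block-⊙ W₁ (O n₁ n₂) (O n₂ n₁) W₂ x y) ⟩
    ∣ (W₁ ⊙ x ⊕ O n₁ n₂ ⊙ y) ++ (O n₂ n₁ ⊙ x ⊕ W₂ ⊙ y) ∣
      ≡⟨ cong₂ (λ a b → ∣ (W₁ ⊙ x ⊕ a) ++ (b ⊕ W₂ ⊙ y) ∣) (O-⊙ n₁ y) (O-⊙ n₂ x) ⟩
    ∣ (W₁ ⊙ x ⊕ zeros n₁) ++ (zeros n₂ ⊕ W₂ ⊙ y) ∣
      ≡⟨ cong₂ (λ a b → ∣ a ++ b ∣) (⊕-identityʳ (W₁ ⊙ x)) (⊕-identityˡ (W₂ ⊙ y)) ⟩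
    ∣ W₁ ⊙ x ++ W₂ ⊙ y ∣
      ≡⟨ ∣++∣ (W₁ ⊙ x) (W₂ ⊙ y) ⟩
    ∣ W₁ ⊙ x ∣ + ∣ W₂ ⊙ y ∣
      ≤⟨ +-mono-≤ (image≤ w₁ x) (image≤ w₂ y) ⟩
    u₁ + u₂ ∎

copies : ∀ {n m u} q → Witness n m u → Witness (q * n) m (q * u)
copies zero w = empty
copies (suc q) w = blockDiagonal w (copies q w)

lowerHalfOnes : ∀ N → Matrix (N + N) 1
lowerHalfOnes N = O N 1 ++ replicate N (true ∷ [])

double : ∀ {N} → Mat N → Mat (N + N + 1)
double {N} S = block (block S S S S) (lowerHalfOnes N) (O 1 (N + N)) I₁

double-⊙ : ∀ {N} (S : Mat N) y z t →
           double S ⊙ ((y ++ z) ++ t ∷ []) ≡ (S ⊙ (y ⊕ z) ++ (S ⊙ (y ⊕ z) ⊕ replicate N t)) ++ t ∷ []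
double-⊙ {N} S y z t = begin
  double S ⊙ ((y ++ z) ++ t ∷ [])
    ≡⟨ block-⊙ (block S S S S) Q (O 1 (N + N)) I₁ (y ++ z) (t ∷ []) ⟩
  (block S S S S ⊙ (y ++ z) ⊕ Q ⊙ (t ∷ [])) ++ (O 1 (N + N) ⊙ (y ++ z) ⊕ I₁ ⊙ (t ∷ []))
    ≡⟨ cong₂ _++_ (cong₂ _⊕_ doubled Q⊙t) (cong (λ b → b ⊕ I₁ ⊙ (t ∷ [])) (O-⊙ 1 (y ++ z))) ⟩
  ((v ++ v) ⊕ (zeros N ++ replicate N t)) ++ ((t xor false) ∷ [])
    ≡⟨ cong₂ _++_ (zipWith-++ _xor_ v v (zeros N) (replicate N t))
                  (cong (_∷ []) (xor-identityʳ t)) ⟩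
  ((v ⊕ zeros N) ++ (v ⊕ replicate N t)) ++ t ∷ []
    ≡⟨ cong (λ a → (a ++ (v ⊕ replicate N t)) ++ t ∷ []) (⊕-identityʳ v) ⟩
  (v ++ (v ⊕ replicate N t)) ++ t ∷ [] ∎
  where
  open ≡-Reasoning
  v = S ⊙ (y ⊕ z)
  Q = lowerHalfOnes N
  doubled : block S S S S ⊙ (y ++ z) ≡ v ++ v
  doubled = trans (block-⊙ S S S S y z) (cong (λ a → a ++ a) (sym (⊙-⊕ S y z)))
  Q⊙t : Q ⊙ (t ∷ []) ≡ zeros N ++ replicate N t
  Q⊙t = trans (map-++ (λ row → dot row (t ∷ [])) (O N 1) (replicate N (true ∷ [])))
          (cong₂ _++_ (O-⊙ N (t ∷ []))
            (trans (map-replicate (λ row → dot row (t ∷ [])) (true ∷ []) N)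
                   (cong (replicate N) (xor-identityʳ t))))

doubling : ∀ {N c} → N + 1 ≤ 2 * c → Witness N c c → Witness (N + N + 1) (2 * c) (2 * c)
doubling {N} {c} N+1≤2c w = record
  { matrix       = double S
  ; unitDiagonal = block-unitDiagonal (block S S S S) Q R I₁ (block-unitDiagonal S S S S diagS diagS) λ { zero → refl }
  ; column≤      = ↑-split {N + N} old new
  ; image≤       = ++-split {m = N + N} λ yz → λ { (t ∷ []) → ++-split {m = N} (λ y z → image y z t) yz }
  }
  where
  open ≤-Reasoning
  S = matrix w
  diagS = unitDiagonal w
  Q = lowerHalfOnes N
  R = O 1 (N + N)

  twice : ∀ {a b} → a ≤ c → b ≤ c → a + b ≤ 2 * c
  twice a≤c b≤c = ≤-trans (+-mono-≤ a≤c b≤c) (≤-reflexive (cong (c +_) (sym (+-identityʳ c))))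

  columnS≤ : ∀ j → ∣ column (block S S S S) j ∣ ≤ 2 * c
  columnS≤ = ↑-split
    (λ j → ≤-trans (≤-reflexive (∣column-block-↑ˡ∣ S S S S j)) (twice (column≤ w j) (column≤ w j)))
    (λ j → ≤-trans (≤-reflexive (∣column-block-↑ʳ∣ S S S S j)) (twice (column≤ w j) (column≤ w j)))

  old : ∀ j → ∣ column (double S) (j ↑ˡ 1) ∣ ≤ 2 * c
  old j = begin
    ∣ column (double S) (j ↑ˡ 1) ∣               ≡⟨ ∣column-block-↑ˡ∣ (block S S S S) Q R I₁ j ⟩
    ∣ column (block S S S S) j ∣ + ∣ column R j ∣ ≡⟨ cong (λ a → ∣ column (block S S S S) j ∣ + ∣ a ∣) (column-O 1 j) ⟩
    ∣ column (block S S S S) j ∣ + 0             ≡⟨ +-identityʳ _ ⟩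
    ∣ column (block S S S S) j ∣                 ≤⟨ columnS≤ j ⟩
    2 * c                                        ∎

  new : ∀ j → ∣ column (double S) ((N + N) ↑ʳ j) ∣ ≤ 2 * c
  new zero = begin
    ∣ column (double S) ((N + N) ↑ʳ zero) ∣    ≡⟨ ∣column-block-↑ʳ∣ (block S S S S) Q R I₁ zero ⟩
    ∣ column Q zero ∣ + 1                      ≡⟨ cong (_+ 1) (∣column-++∣ (O N 1) (replicate N (true ∷ [])) zero) ⟩
    ∣ column (O N 1) zero ∣ + ∣ column (replicate N (true ∷ [])) zero ∣ + 1
      ≡⟨ cong₂ (λ a b → ∣ a ∣ + ∣ b ∣ + 1) (column-O N zero) (map-replicate (λ row → lookup row zero) (true ∷ []) N) ⟩
    ∣ zeros N ∣ + ∣ ones N ∣ + 1                 ≡⟨ cong₂ (λ a b → a + b + 1) (∣zeros∣ N) (∣ones∣ N) ⟩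
    N + 1                                      ≤⟨ N+1≤2c ⟩
    2 * c                                      ∎

  image : ∀ y z t → ∣ double S · ((y ++ z) ++ t ∷ []) ∣ ≤ 2 * c
  image y z t = begin
    ∣ double S ⊙ ((y ++ z) ++ t ∷ []) ∣          ≡⟨ cong ∣_∣ (double-⊙ S y z t) ⟩
    ∣ (v ++ (v ⊕ replicate N t)) ++ t ∷ [] ∣     ≡⟨ ∣++∣ (v ++ (v ⊕ replicate N t)) (t ∷ []) ⟩
    ∣ v ++ (v ⊕ replicate N t) ∣ + ∣ t ∷ [] ∣    ≡⟨ cong (_+ ∣ t ∷ [] ∣) (∣++∣ v (v ⊕ replicate N t)) ⟩
    ∣ v ∣ + ∣ v ⊕ replicate N t ∣ + ∣ t ∷ [] ∣   ≤⟨ bound t ⟩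
    2 * c                                      ∎
    where
    v = S ⊙ (y ⊕ z)
    v≤c = image≤ w (y ⊕ z)
    bound : ∀ t → ∣ v ∣ + ∣ v ⊕ replicate N t ∣ + ∣ t ∷ [] ∣ ≤ 2 * c
    bound false = begin
      ∣ v ∣ + ∣ v ⊕ zeros N ∣ + 0 ≡⟨ +-identityʳ _ ⟩
      ∣ v ∣ + ∣ v ⊕ zeros N ∣     ≡⟨ cong (λ a → ∣ v ∣ + ∣ a ∣) (⊕-identityʳ v) ⟩
      ∣ v ∣ + ∣ v ∣               ≤⟨ twice v≤c v≤c ⟩
      2 * c                     ∎
    bound true = begin
      ∣ v ∣ + ∣ v ⊕ ones N ∣ + 1 ≡⟨ cong (_+ 1) (∣u∣+∣u⊕ones∣≡n v) ⟩
      N + 1                    ≤⟨ N+1≤2c ⟩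
      2 * c                    ∎

blockSize : ℕ → ℕ
blockSize zero = 1
blockSize (suc k) = blockSize k + blockSize k + 1

blockSize+1≡2^[1+k] : ∀ k → blockSize k + 1 ≡ 2 ^ suc k
blockSize+1≡2^[1+k] zero = refl
blockSize+1≡2^[1+k] (suc k) = begin
  s + s + 1 + 1       ≡⟨ +-assoc (s + s) 1 1 ⟩
  s + s + 2           ≡⟨ +-assoc s s 2 ⟩
  s + (s + 2)         ≡⟨ cong (s +_) (+-suc s 1) ⟩
  s + (1 + (s + 1))   ≡⟨ sym (+-assoc s 1 (s + 1)) ⟩
  (s + 1) + (s + 1)   ≡⟨ cong (λ p → p + p) (blockSize+1≡2^[1+k] k) ⟩
  2 ^ suc k + 2 ^ suc k ≡⟨ cong (2 ^ suc k +_) (sym (+-identityʳ (2 ^ suc k))) ⟩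
  2 * 2 ^ suc k       ∎
  where
  open ≡-Reasoning
  s = blockSize k

simplex : ∀ k → Witness (blockSize k) (2 ^ k) (2 ^ k)
simplex zero = record
  { matrix       = I₁
  ; unitDiagonal = λ { zero → refl }
  ; column≤      = λ { zero → ≤-refl }
  ; image≤       = λ { (false ∷ []) → z≤n ; (true ∷ []) → ≤-refl }
  }
simplex (suc k) = doubling (≤-reflexive (blockSize+1≡2^[1+k] k)) (simplex k)

2^⌊log₂n⌋≤n : ∀ n → 1 ≤ n → 2 ^ ⌊log₂ n ⌋ ≤ n
2^⌊log₂n⌋≤n (suc n) _ = go n _
  where
  open ≤-Reasoning
  -- ⌊log₂ n⌋ is ⌊log2⌋ n applied to an accessibility proof, and unfolds along it.
  go : ∀ n (rec : Acc _<_ (suc n)) → 2 ^ ⌊log2⌋ (suc n) rec ≤ suc n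
  go zero _ = ≤-refl
  go (suc n) (acc rs) = begin
    2 * 2 ^ ⌊log2⌋ (suc h) _   ≤⟨ *-monoʳ-≤ 2 (go h _) ⟩
    2 * suc h                  ≡⟨ *-suc 2 h ⟩
    2 + (h + (h + 0))          ≡⟨ cong (λ a → 2 + (h + a)) (+-identityʳ h) ⟩
    2 + (h + h)                ≤⟨ +-monoʳ-≤ 2 (+-monoʳ-≤ h (⌊n/2⌋≤⌈n/2⌉ n)) ⟩
    2 + (h + ⌈ n /2⌉)          ≡⟨ cong (2 +_) (⌊n/2⌋+⌈n/2⌉≡n n) ⟩
    suc (suc n)                ∎
    where
    h = ⌊ n /2⌋

1≤⌊log₂[n+1]⌋ : ∀ {n} → 1 ≤ n → 1 ≤ ⌊log₂ (n + 1) ⌋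
1≤⌊log₂[n+1]⌋ 1≤n = ⌊log₂⌋-mono-≤ {2} (+-monoˡ-≤ 1 1≤n)

⌊log₂[n+1]⌋≤ : ∀ {n} k → n < 2 ^ k → ⌊log₂ (n + 1) ⌋ ≤ k
⌊log₂[n+1]⌋≤ {n} k n<2^k =
  subst (_ ≤_) (⌊log₂[2^n]⌋≡n k) (⌊log₂⌋-mono-≤ (≤-trans (≤-reflexive (+-comm n 1)) n<2^k))

blockSize+remainder≡n : ∀ K n → 2 ^ suc K < n + 1 → blockSize K + (n + 1 ∸ 2 ^ suc K) ≡ n
blockSize+remainder≡n K n 2^[1+K]<n+1 = begin
  s + (n + 1 ∸ 2 ^ suc K)   ≡⟨ cong (λ p → s + (n + 1 ∸ p)) (sym (blockSize+1≡2^[1+k] K)) ⟩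
  s + (n + 1 ∸ (s + 1))     ≡⟨ cong₂ (λ a b → s + (a ∸ b)) (+-comm n 1) (+-comm s 1) ⟩
  s + (n ∸ s)               ≡⟨ m+[n∸m]≡n s≤n ⟩
  n                         ∎
  where
  open ≡-Reasoning
  s = blockSize K
  s≤n : s ≤ n
  s≤n = +-cancelʳ-≤ 1 s n (≤-trans (≤-reflexive (blockSize+1≡2^[1+k] K)) (<⇒≤ 2^[1+K]<n+1))

-- The two branches of aF: n + 1 is a power 2^K, or a block of size 2^K - 1 is split off.
fullBlock : ∀ {k n} K → 1 ≤ K → K ≤ suc k → n + 1 ≡ 2 ^ K → Witness n (2 ^ k) (2 ^ (K ∸ 1))
fullBlock (suc K) _ (s≤s K≤k) n+1≡2^K =
  weaken (^-monoʳ-≤ 2 K≤k)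
    (subst (λ s → Witness s (2 ^ K) (2 ^ K))
           (+-cancelʳ-≡ 1 (blockSize K) _ (trans (blockSize+1≡2^[1+k] K) (sym n+1≡2^K)))
           (simplex K))

splitBlock : ∀ {k n} {g : ℕ → ℕ} K → 1 ≤ K → K ≤ suc k → 2 ^ K < n + 1 →
             (∀ i → 1 ≤ i → i < n → Witness i (2 ^ k) (g i)) →
             Witness n (2 ^ k) (2 ^ (K ∸ 1) + g (n + 1 ∸ 2 ^ K))
splitBlock {k} {n} {g} (suc K) _ (s≤s K≤k) 2^K<n+1 rest =
  subst (λ s → Witness s (2 ^ k) (2 ^ K + g i)) (blockSize+remainder≡n K n 2^K<n+1)
    (blockDiagonal (weaken (^-monoʳ-≤ 2 K≤k) (simplex K)) (rest i 1≤i i<n))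
  where
  i = n + 1 ∸ 2 ^ suc K
  1≤i : 1 ≤ i
  1≤i = m<n⇒0<n∸m 2^K<n+1
  i<n : i < n
  i<n = subst (i <_) (m+n∸n≡m n 1) (∸-monoʳ-< (^-monoʳ-≤ 2 (s≤s (z≤n {K}))) (<⇒≤ 2^K<n+1))

aWitness : ∀ k f n → 1 ≤ n → n ≤ f → n < 2 ^ suc k → Witness n (2 ^ k) (aF f n)
aWitness k zero n 1≤n n≤0 _ = ⊥-elim (<⇒≱ 1≤n n≤0)
aWitness k (suc f) n 1≤n n≤1+f n<2^[1+k] with (n + 1) ≡ᵇ 2 ^ ⌊log₂ (n + 1) ⌋ in eq
... | true  = fullBlock _ (1≤⌊log₂[n+1]⌋ 1≤n) (⌊log₂[n+1]⌋≤ (suc k) n<2^[1+k])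
                (≡ᵇ⇒≡ (n + 1) _ (subst T (sym eq) tt))
... | false = splitBlock _ (1≤⌊log₂[n+1]⌋ 1≤n) (⌊log₂[n+1]⌋≤ (suc k) n<2^[1+k]) 2^K<n+1
                (λ i 1≤i i<n → aWitness k f i 1≤i (≤-pred (≤-trans i<n n≤1+f)) (<-trans i<n n<2^[1+k]))
  where
  2^K<n+1 = ≤∧≢⇒< (2^⌊log₂n⌋≤n (n + 1) (m≤n+m 1 n)) (λ e → subst T eq (≡⇒≡ᵇ (n + 1) _ (sym e)))

∈-allVecs : ∀ {A : Set} (xs : List A) → (∀ x → x ∈ xs) → ∀ {n} (v : Vec A n) → v ∈ allVecs xs n
∈-allVecs xs _ [] = here refl
∈-allVecs xs complete {suc n} (x ∷ v) = go xs (complete x)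
  where
  go : ∀ ys → x ∈ ys → (x ∷ v) ∈ concatMap (λ a → List.map (a ∷_) (allVecs xs n)) ys
  go (y ∷ ys) (here refl) = ∈-++⁺ˡ (∈-map⁺ (x ∷_) (∈-allVecs xs complete v))
  go (y ∷ ys) (there p)   = ∈-++⁺ʳ (List.map (y ∷_) (allVecs xs n)) (go ys p)

∈-bools : ∀ b → b ∈ false ∷ true ∷ []
∈-bools false = here refl
∈-bools true  = there (here refl)

and-toList : ∀ {n} (v : Vec Bool n) → (∀ i → lookup v i ≡ true) → and (toList v) ≡ true
and-toList [] _ = refl
and-toList (true ∷ v) allTrue = and-toList v (λ i → allTrue (suc i))
and-toList (false ∷ v) allTrue with () ← allTrue zero

lookup-transpose : ∀ {A : Set} {k n} (W : Vec (Vec A n) k) j → lookup (transpose W) j ≡ map (λ row → lookup row j) W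
lookup-transpose [] j = lookup-replicate j []
lookup-transpose {A = A} {n = n} (r ∷ W) j = begin
  lookup (replicate n cons ⊛ r ⊛ transpose W) j
    ≡⟨ lookup-⊛ j (replicate n cons ⊛ r) (transpose W) ⟩
  lookup (replicate n cons ⊛ r) j (lookup (transpose W) j)
    ≡⟨ cong (λ f → f (lookup (transpose W) j)) (lookup-⊛ j (replicate n cons) r) ⟩
  lookup (replicate n cons) j (lookup r j) (lookup (transpose W) j)
    ≡⟨ cong (λ f → f (lookup r j) (lookup (transpose W) j)) (lookup-replicate j cons) ⟩
  lookup r j ∷ lookup (transpose W) j
    ≡⟨ cong (lookup r j ∷_) (lookup-transpose W j) ⟩
  lookup r j ∷ map (λ row → lookup row j) W ∎
  where
  open ≡-Reasoning
  cons : A → Vec A _ → Vec A _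
  cons = _∷_

inAᵇ-witness : ∀ {n m u} (w : Witness n m u) → inAᵇ m (matrix w) ≡ true
inAᵇ-witness {m = m} w = cong₂ _∧_
  (and-toList (tabulate (λ i → lookup (lookup W i) i)) λ i → trans (lookup∘tabulate _ i) (unitDiagonal w i))
  (and-toList (map (λ col → ∣ col ∣ ≤ᵇ m) (transpose W)) λ j → trans (lookup-map j _ (transpose W))
    (Equivalence.to T-≡ (≤⇒≤ᵇ (subst (λ c → ∣ c ∣ ≤ m) (sym (lookup-transpose W j)) (column≤ w j)))))
  where W = matrix w

∈-A : ∀ {n m u} (w : Witness n m u) → matrix w ∈ A n m
∈-A {n} {m} w = ∈-filter⁺ (λ W → Data.Bool._≟_ (inAᵇ m W) true)
  (∈-allVecs (allF₂^ n) (∈-allVecs (false ∷ true ∷ []) ∈-bools) (matrix w)) (inAᵇ-witness w)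

foldr-⊔-≤ : ∀ {A : Set} (f : A → ℕ) {u} (xs : List A) → (∀ x → f x ≤ u) → foldr _⊔_ 0 (List.map f xs) ≤ u
foldr-⊔-≤ f [] _ = z≤n
foldr-⊔-≤ f (x ∷ xs) f≤u = ⊔-lub (f≤u x) (foldr-⊔-≤ f xs f≤u)

foldr-⊓-≤ : ∀ {A : Set} (f : A → ℕ) z {xs : List A} {x} → x ∈ xs → foldr _⊓_ z (List.map f xs) ≤ f x
foldr-⊓-≤ f z {y ∷ _} (here refl) = m⊓n≤m (f y) _
foldr-⊓-≤ f z {y ∷ _} (there x∈xs) = ≤-trans (m⊓n≤n (f y) _) (foldr-⊓-≤ f z x∈xs)

μ≤ : ∀ {n m u} → Witness n m u → μ n m ≤ u
μ≤ {n} w = ≤-trans (foldr-⊓-≤ M₀ n (∈-A w)) (foldr-⊔-≤ (λ x → ∣ matrix w · x ∣) (allF₂^ n) (image≤ w))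

B≡blockSize : ∀ m → B m ≡ blockSize ⌊log₂ m ⌋
B≡blockSize m = begin
  suc (2 ^ suc k ∸ 2)       ≡⟨ cong (λ p → suc (p ∸ 2)) (sym (blockSize+1≡2^[1+k] k)) ⟩
  suc (s + 1 ∸ 2)           ≡⟨ cong (λ p → suc (p ∸ 2)) (+-comm s 1) ⟩
  suc (s ∸ 1)               ≡⟨ +-comm 1 (s ∸ 1) ⟩
  s ∸ 1 + 1                 ≡⟨ m∸n+n≡m (1≤blockSize k) ⟩
  s                         ∎
  where
  open ≡-Reasoning
  k = ⌊log₂ m ⌋
  s = blockSize k
  1≤blockSize : ∀ k → 1 ≤ blockSize k
  1≤blockSize zero = ≤-refl
  1≤blockSize (suc k) = ≤-trans (1≤blockSize k) (≤-trans (m≤m+n _ _) (m≤m+n _ 1))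

q*blockSize+r≡n : ∀ n m → 1 ≤ n → (n ∸ 1) / B m * blockSize ⌊log₂ m ⌋ + ((n ∸ 1) % B m + 1) ≡ n
q*blockSize+r≡n n m 1≤n = begin
  q * blockSize ⌊log₂ m ⌋ + (ρ + 1) ≡⟨ cong (λ b → q * b + (ρ + 1)) (sym (B≡blockSize m)) ⟩
  q * B m + (ρ + 1)                 ≡⟨ sym (+-assoc (q * B m) ρ 1) ⟩
  q * B m + ρ + 1                   ≡⟨ cong (_+ 1) (+-comm (q * B m) ρ) ⟩
  ρ + q * B m + 1                   ≡⟨ cong (_+ 1) (sym (m≡m%n+[m/n]*n (n ∸ 1) (B m))) ⟩
  n ∸ 1 + 1                         ≡⟨ m∸n+n≡m 1≤n ⟩
  n                                 ∎
  where
  open ≡-Reasoning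
  q = (n ∸ 1) / B m
  ρ = (n ∸ 1) % B m

remainder<2^[1+⌊log₂m⌋] : ∀ n m → (n ∸ 1) % B m + 1 < 2 ^ suc ⌊log₂ m ⌋
remainder<2^[1+⌊log₂m⌋] n m = subst ((n ∸ 1) % B m + 1 <_) (blockSize+1≡2^[1+k] ⌊log₂ m ⌋)
  (+-monoˡ-< 1 (subst ((n ∸ 1) % B m <_) (B≡blockSize m) (m%n<n (n ∸ 1) (B m))))

proposition4p1 : (n m : ℕ) → 1 ≤ n → 1 ≤ m → μ n m ≤ U n m
proposition4p1 n m 1≤n 1≤m =
  μ≤ (subst (λ s → Witness s m (U n m)) (q*blockSize+r≡n n m 1≤n)
        (weaken (2^⌊log₂n⌋≤n m 1≤m)
          (blockDiagonal (copies q (simplex k)) (aWitness k r r (m≤n+m 1 _) ≤-refl (remainder<2^[1+⌊log₂m⌋] n m)))))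
  where
  k = ⌊log₂ m ⌋
  q = (n ∸ 1) / B m
  r = (n ∸ 1) % B m + 1
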